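{- Let $r$ be an arithmetic function with $r(1)\neq 0$, let $r^{ -1}$ denote its Dirichlet inverse, and define $\widetilde{R}(x):=\sum_{n\le x}(r\ast\mu)(n)$, where $\ast$ is Dirichlet convolution and $\mu$ is the Möbius function. Then for all integers $x\ge 1$, the Mertens function $M(x):=\sum_{n\le x}\mu(n)$ satisfies \[ M(x)=\sum_{k=1}^{x}\left(\sum_{j=\lfloor x/(k+1)\rfloor+1}^{\lfloor x/k\rfloor} r^{ -1}(j)\right)\widetilde{R}(k). \]
   Context: Dirichlet convolution: $(f\ast g)(n)=\sum_{d\mid n} f(d)g(n/d)$. The Dirichlet inverse $r^{ -1}$ of $r$ with $r(1)\neq0$ satisfies $r\ast r^{ -1}=\varepsilon$, where $\varepsilon(n)=1$ if $n=1$ and $0$ otherwise. -}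

module Defs where

open import Level using (Level)
import Data.Nat as N
open N using (ℕ; zero; suc; _/_)
open import Data.Nat.Divisibility using (_∣?_)
open import Data.Integer using (ℤ; +_; -[1+_]) renaming (-_ to -ℤ_)
open import Data.List using (List; []; _∷_; map; upTo; applyUpTo; foldr)
open import Data.Bool using (if_then_else_)
open import Relation.Nullary.Decidable using (does)
open import Algebra.Bundles using (CommutativeRing)

-- Möbius function (integer valued), via the standard recursion on the
-- least prime factor p of n ≥ 2:  μ(1) = 1,  μ(n) = 0 if p² ∣ n,
-- μ(n) = - μ(n/p) otherwise.  (μ(0) = 0 is a junk value.)

-- lpfm n = m where m + 2 is the least divisor ≥ 2 of n (for n ≥ 2).
lpfm : ℕ → ℕ
lpfm n = go 0 n
  where
  go : ℕ → ℕ → ℕ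
  go m zero    = m
  go m (suc k) = if does (suc (suc m) ∣? n) then m else go (suc m) k

μ-fuel : ℕ → ℕ → ℤ
μ-fuel zero    _               = + 0
μ-fuel (suc f) zero            = + 0
μ-fuel (suc f) (suc zero)      = + 1
μ-fuel (suc f) n@(suc (suc _)) =
  let p = suc (suc (lpfm n)) in
  if does ((p N.* p) ∣? n) then + 0 else -ℤ μ-fuel f (n / p)

μ : ℕ → ℤ
μ n = μ-fuel n n

-- Arithmetic functions with values in a commutative ring R
-- (represented as ℕ → Carrier; the value at 0 is irrelevant).

module ArithFun {c ℓ : Level} (R : CommutativeRing c ℓ) where
  open CommutativeRing R
  open N using () renaming (_+_ to _+ℕ_; _*_ to _*ℕ_; _∸_ to _∸ℕ_)

  fromℕ : ℕ → Carrier
  fromℕ zero    = 0#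
  fromℕ (suc n) = 1# + fromℕ n

  fromℤ : ℤ → Carrier
  fromℤ (+ n)      = fromℕ n
  fromℤ -[1+ n ]   = - fromℕ (suc n)

  sumL : List Carrier → Carrier
  sumL = foldr _+_ 0#

  -- Σ_{j=a}^{b} f j  (empty if b < a)
  sumFromTo : (ℕ → Carrier) → ℕ → ℕ → Carrier
  sumFromTo f a b = sumL (applyUpTo (λ i → f (a +ℕ i)) (suc b ∸ℕ a))

  sumTo : (ℕ → Carrier) → ℕ → Carrier
  sumTo f x = sumFromTo f 1 x

  _⋆_ : (ℕ → Carrier) → (ℕ → Carrier) → ℕ → Carrier
  (f ⋆ g) n = sumL (map term (upTo n))
    where
    term : ℕ → Carrier
    term i = if does (suc i ∣? n) then f (suc i) * g (n / suc i) else 0#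

  ε : ℕ → Carrier
  ε (suc zero) = 1#
  ε _          = 0#

  μR : ℕ → Carrier
  μR n = fromℤ (μ n)

  IsDirichletInverse : (ℕ → Carrier) → (ℕ → Carrier) → Set ℓ
  IsDirichletInverse r rinv = ∀ n → 1 N.≤ n → (r ⋆ rinv) n ≈ ε n

  M : ℕ → Carrier
  M x = sumTo μR x

  Rtilde : (ℕ → Carrier) → ℕ → Carrier
  Rtilde r x = sumTo (r ⋆ μR) x

  -- Σ_{k=1}^{x} f k  for a summand that may use k ≠ 0 (e.g. to divide by k)
  sumOneTo : ((k : ℕ) → .{{N.NonZero k}} → Carrier) → ℕ → Carrier
  sumOneTo f x = sumL (applyUpTo (λ i → f (suc i)) x)

{-# OPTIONS --safe #-}
-- Write (f ◃ G)(x) = Σ_{d ≤ x} f(d) G(⌊x/d⌋).  Since ⌊⌊x/d⌋/e⌋ = ⌊x/de⌋, this is an action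
-- of Dirichlet convolution: (f ∗ g) ◃ G = f ◃ (g ◃ G) and ε ◃ G = G.  Moreover
-- f ◃ (g ◃ G) = g ◃ (f ◃ G), both being the sum of f(d) g(e) G(⌊x/de⌋) over the lattice
-- points de ≤ x.  As M = μ ◃ 1 and R̃ = (r ∗ μ) ◃ 1 = r ◃ M, we get
-- M = (r ∗ r⁻¹) ◃ M = r⁻¹ ◃ (r ◃ M) = r⁻¹ ◃ R̃, and grouping the terms r⁻¹(j) R̃(⌊x/j⌋)
-- of the last sum by k = ⌊x/j⌋, i.e. ⌊x/(k+1)⌋ < j ≤ ⌊x/k⌋, gives the formula.
module Submission where

open import Level using (Level)
open import Function using (id)
open import Data.Bool using (if_then_else_)
open import Data.Empty using (⊥-elim)
open import Data.Product using (_×_; _,_; uncurry)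
open import Data.List using (foldr; applyUpTo)
open import Data.List.Properties using (map-applyUpTo)
open import Data.Nat using (ℕ; zero; suc; _≤_; _<_; _/_; z≤n; s≤s; NonZero; >-nonZero⁻¹)
  renaming (_+_ to _+ℕ_; _*_ to _*ℕ_)
import Data.Nat.Properties as ℕₚ
open ℕₚ using (≤-trans; ≤-antisym; ≤-reflexive; ≤-pred; *-monoˡ-≤; m<n+m; n≤1+n; ≤∧≢⇒<;
                ≮⇒≥; ≰⇒>; <⇒≱; ≤⇒≯; 1+n≰n; _≟_; _≤?_; _<?_)
open import Data.Nat.DivMod using (m*n/n≡m; m/n*n≤m; m*[n/m]≡n; m/n≤m; n/1≡n; m≥n⇒m/n>0;
                                   m<n*o⇒m/o<n; m/n/o≡m/[n*o]; /-monoˡ-≤; /-congˡ; /-congʳ)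
open import Data.Nat.Divisibility using (_∣_; _∣?_; divides; ∣⇒≤)
open import Relation.Nullary using (¬_; Dec; yes; no)
open import Relation.Nullary.Decidable using (does; _×-dec_)
open import Relation.Binary.PropositionalEquality as ≡ using (_≡_; module ≡-Reasoning)
open import Algebra.Bundles using (CommutativeSemiring; CommutativeRing)
open import Defs

m*n≤o⇒m≤o/n : ∀ {m o} n .{{_ : NonZero n}} → m *ℕ n ≤ o → m ≤ o / n
m*n≤o⇒m≤o/n {m} {o} n h = ≡.subst (_≤ o / n) (m*n/n≡m m n) (/-monoˡ-≤ n h)

m≤o/n⇒m*n≤o : ∀ {m o} n .{{_ : NonZero n}} → m ≤ o / n → m *ℕ n ≤ o
m≤o/n⇒m*n≤o {m} {o} n h = ≤-trans (*-monoˡ-≤ n h) (m/n*n≤m o n)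

m≤o/n⇒n≤o/m : ∀ {o} m n .{{_ : NonZero m}} .{{_ : NonZero n}} → m ≤ o / n → n ≤ o / m
m≤o/n⇒n≤o/m {o} m n h = m*n≤o⇒m≤o/n m (≡.subst (_≤ o) (ℕₚ.*-comm m n) (m≤o/n⇒m*n≤o n h))

x/n≡m⇒x/[1+m]<n≤x/m : ∀ {x} n m .{{_ : NonZero n}} .{{_ : NonZero m}} →
                      x / n ≡ m → x / suc m < n × n ≤ x / m
x/n≡m⇒x/[1+m]<n≤x/m n m e =
  ≰⇒> (λ n≤ → 1+n≰n (≡.subst (suc m ≤_) e (m≤o/n⇒n≤o/m n (suc m) n≤)))
  , m≤o/n⇒n≤o/m m n (≤-reflexive (≡.sym e))

x/[1+m]<n≤x/m⇒x/n≡m : ∀ {x} n m .{{_ : NonZero n}} .{{_ : NonZero m}} →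
                      x / suc m < n → n ≤ x / m → x / n ≡ m
x/[1+m]<n≤x/m⇒x/n≡m n m lower upper =
  ≤-antisym (≮⇒≥ (λ m< → <⇒≱ lower (m≤o/n⇒n≤o/m (suc m) n m<)))
            (m≤o/n⇒n≤o/m n m upper)

1+n/d≡1+[n/d] : ∀ {n} d .{{_ : NonZero d}} → d ∣ suc n → suc n / d ≡ suc (n / d)
1+n/d≡1+[n/d] {n} d (divides (suc c) eq) = begin
  suc n / d      ≡⟨ /-congˡ eq ⟩
  suc c *ℕ d / d ≡⟨ m*n/n≡m (suc c) d ⟩
  suc c          ≡⟨ ≡.cong suc (≡.sym n/d≡c) ⟩
  suc (n / d)    ∎
  where
  open ≡-Reasoning
  c*d<1+n : c *ℕ d < suc n
  c*d<1+n = ≡.subst (c *ℕ d <_) (≡.sym eq) (m<n+m (c *ℕ d) (>-nonZero⁻¹ d))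
  n/d≡c : n / d ≡ c
  n/d≡c = ≤-antisym (≤-pred (m<n*o⇒m/o<n (≤-reflexive eq))) (m*n≤o⇒m≤o/n d (≤-pred c*d<1+n))

1+n/d≡n/d : ∀ {n} d .{{_ : NonZero d}} → ¬ (d ∣ suc n) → suc n / d ≡ n / d
1+n/d≡n/d {n} d d∤1+n = ≤-antisym (m*n≤o⇒m≤o/n d (≤-pred q*d<1+n)) (/-monoˡ-≤ d (n≤1+n n))
  where
  q*d<1+n : suc n / d *ℕ d < suc n
  q*d<1+n = ≤∧≢⇒< (m/n*n≤m (suc n) d) (λ e → d∤1+n (divides (suc n / d) (≡.sym e)))

x/[1+n]≡x/d/[1+n/d] : ∀ {n} x d .{{_ : NonZero d}} → d ∣ suc n → x / suc n ≡ x / d / suc (n / d)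
x/[1+n]≡x/d/[1+n/d] {n} x d@(suc _) d∣1+n = begin
  x / suc n                ≡⟨ /-congʳ {m = x} (≡.sym d*[1+n/d]≡1+n) ⟩
  x / (d *ℕ suc (n / d))   ≡⟨ ≡.sym (m/n/o≡m/[n*o] x d (suc (n / d))) ⟩
  x / d / suc (n / d)      ∎
  where
  open ≡-Reasoning
  d*[1+n/d]≡1+n : d *ℕ suc (n / d) ≡ suc n
  d*[1+n/d]≡1+n = ≡.trans (≡.cong (d *ℕ_) (≡.sym (1+n/d≡1+[n/d] d d∣1+n))) (m*[n/m]≡n d∣1+n)

module FiniteSums {c ℓ : Level} (S : CommutativeSemiring c ℓ) where
  open CommutativeSemiring S
  open import Relation.Binary.Reasoning.Setoid setoid
  open import Algebra.Properties.CommutativeSemigroup +-commutativeSemigroup using (interchange)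

  ∑ : ℕ → (ℕ → Carrier) → Carrier
  ∑ n f = foldr _+_ 0# (applyUpTo f n)

  when : {A : Set} → Dec A → Carrier → Carrier
  when a? x = if does a? then x else 0#

  ∑-cong : ∀ n {f g} → (∀ i → i < n → f i ≈ g i) → ∑ n f ≈ ∑ n g
  ∑-cong zero    f≈g = refl
  ∑-cong (suc n) f≈g = +-cong (f≈g 0 (s≤s z≤n)) (∑-cong n (λ i i<n → f≈g (suc i) (s≤s i<n)))

  ∑-zero : ∀ n {f} → (∀ i → i < n → f i ≈ 0#) → ∑ n f ≈ 0#
  ∑-zero zero    f≈0 = refl
  ∑-zero (suc n) f≈0 = trans (+-cong (f≈0 0 (s≤s z≤n)) (∑-zero n (λ i i<n → f≈0 (suc i) (s≤s i<n))))
                             (+-identityˡ 0#)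

  ∑-distrib : ∀ n f g → ∑ n (λ i → f i + g i) ≈ ∑ n f + ∑ n g
  ∑-distrib zero    f g = sym (+-identityˡ 0#)
  ∑-distrib (suc n) f g = trans (+-congˡ (∑-distrib n (λ i → f (suc i)) (λ i → g (suc i))))
                                (interchange (f 0) (g 0) _ _)

  *-distribˡ-∑ : ∀ n a f → a * ∑ n f ≈ ∑ n (λ i → a * f i)
  *-distribˡ-∑ zero    a f = zeroʳ a
  *-distribˡ-∑ (suc n) a f = trans (distribˡ a (f 0) _) (+-congˡ (*-distribˡ-∑ n a (λ i → f (suc i))))

  *-distribʳ-∑ : ∀ n a f → ∑ n f * a ≈ ∑ n (λ i → f i * a)
  *-distribʳ-∑ zero    a f = zeroˡ a
  *-distribʳ-∑ (suc n) a f = trans (distribʳ a (f 0) _) (+-congˡ (*-distribʳ-∑ n a (λ i → f (suc i))))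

  ∑-swap : ∀ m n (h : ℕ → ℕ → Carrier) → ∑ m (λ i → ∑ n (h i)) ≈ ∑ n (λ j → ∑ m (λ i → h i j))
  ∑-swap zero    n h = sym (∑-zero n (λ _ _ → refl))
  ∑-swap (suc m) n h = trans (+-congˡ (∑-swap m n (λ i → h (suc i))))
                             (sym (∑-distrib n (h 0) (λ j → ∑ m (λ i → h (suc i) j))))

  ∑-suc : ∀ n f → ∑ (suc n) f ≈ ∑ n f + f n
  ∑-suc zero    f = +-comm (f 0) 0#
  ∑-suc (suc n) f = trans (+-congˡ (∑-suc n (λ i → f (suc i)))) (sym (+-assoc _ _ _))

  ∑-vanishing-tail : ∀ {m n f} → m ≤ n → (∀ i → m ≤ i → i < n → f i ≈ 0#) → ∑ n f ≈ ∑ m f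
  ∑-vanishing-tail {zero}  {n}     _         f≈0 = ∑-zero n (λ i i<n → f≈0 i z≤n i<n)
  ∑-vanishing-tail {suc m} {suc n} (s≤s m≤n) f≈0 =
    +-congˡ (∑-vanishing-tail m≤n (λ i m≤i i<n → f≈0 (suc i) (s≤s m≤i) (s≤s i<n)))

  when-yes : ∀ {A : Set} (a? : Dec A) {x} → A → when a? x ≈ x
  when-yes (yes _) _ = refl
  when-yes (no ¬a) a = ⊥-elim (¬a a)

  when-no : ∀ {A : Set} (a? : Dec A) {x} → ¬ A → when a? x ≈ 0#
  when-no (yes a) ¬a = ⊥-elim (¬a a)
  when-no (no _)  _  = refl

  when-cong : ∀ {A B : Set} (a? : Dec A) (b? : Dec B) {x y} →
              (A → B) → (B → A) → (A → x ≈ y) → when a? x ≈ when b? y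
  when-cong (yes a) (yes _) _   _   x≈y = x≈y a
  when-cong (yes a) (no ¬b) A→B _   _   = ⊥-elim (¬b (A→B a))
  when-cong (no ¬a) (yes b) _   B→A _   = ⊥-elim (¬a (B→A b))
  when-cong (no _)  (no _)  _   _   _   = refl

  *-distribˡ-when : ∀ {A : Set} (a? : Dec A) x y → x * when a? y ≈ when a? (x * y)
  *-distribˡ-when (yes _) x y = refl
  *-distribˡ-when (no _)  x y = zeroʳ x

  *-distribʳ-when : ∀ {A : Set} (a? : Dec A) x y → when a? x * y ≈ when a? (x * y)
  *-distribʳ-when (yes _) x y = refl
  *-distribʳ-when (no _)  x y = zeroˡ y

  ∑-when-< : ∀ {m n} (f : ℕ → Carrier) → m ≤ n → ∑ n (λ i → when (i <? m) (f i)) ≈ ∑ m f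
  ∑-when-< {m} f m≤n =
    trans (∑-vanishing-tail m≤n (λ i m≤i _ → when-no (i <? m) (≤⇒≯ m≤i)))
          (∑-cong m (λ i i<m → when-yes (i <? m) i<m))

  ∑-when-≡ : ∀ {m n} (f : ℕ → Carrier) → 1 ≤ m → m ≤ n →
             ∑ n (λ k → when (m ≟ suc k) (f (suc k))) ≈ f m
  ∑-when-≡ {suc zero}    {suc n} f _ _ = trans (+-congˡ (∑-zero n (λ _ _ → refl))) (+-identityʳ (f 1))
  ∑-when-≡ {suc (suc m)} {suc n} f _ (s≤s m≤n) =
    trans (+-identityˡ _) (∑-when-≡ (λ k → f (suc k)) (s≤s z≤n) m≤n)

  -- i / d = (i + 1) / d ∸ 1 whenever d ∣ i + 1
  ∑-when-∣ : ∀ n d .{{_ : NonZero d}} (h : ℕ → Carrier) →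
             ∑ n (λ i → when (d ∣? suc i) (h (i / d))) ≈ ∑ (n / d) h
  ∑-when-∣ zero    d@(suc _) h = refl
  ∑-when-∣ (suc n) d         h = begin
    ∑ (suc n) F                                ≈⟨ ∑-suc n F ⟩
    ∑ n F + when (d ∣? suc n) (h (n / d))      ≈⟨ +-congʳ (∑-when-∣ n d h) ⟩
    ∑ (n / d) h + when (d ∣? suc n) (h (n / d)) ≈⟨ last (d ∣? suc n) ⟩
    ∑ (suc n / d) h                            ∎
    where
    F : ℕ → Carrier
    F i = when (d ∣? suc i) (h (i / d))
    last : (d∣? : Dec (d ∣ suc n)) → ∑ (n / d) h + when d∣? (h (n / d)) ≈ ∑ (suc n / d) h
    last (yes d∣1+n) = trans (sym (∑-suc (n / d) h))
                             (reflexive (≡.cong (λ k → ∑ k h) (≡.sym (1+n/d≡1+[n/d] d d∣1+n))))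
    last (no d∤1+n)  = trans (+-identityʳ _)
                             (reflexive (≡.cong (λ k → ∑ k h) (≡.sym (1+n/d≡n/d d d∤1+n))))

module DirichletAction {c ℓ : Level} (R : CommutativeRing c ℓ) where
  open CommutativeRing R
  open ArithFun R
  open FiniteSums commutativeSemiring
  open import Relation.Binary.Reasoning.Setoid setoid

  infixr 7 _◃_
  _◃_ : (ℕ → Carrier) → (ℕ → Carrier) → ℕ → Carrier
  (f ◃ G) x = ∑ x (λ i → f (suc i) * G (x / suc i))

  ◃-congˡ : ∀ {f f′} G → (∀ n → 1 ≤ n → f n ≈ f′ n) → ∀ x → (f ◃ G) x ≈ (f′ ◃ G) x
  ◃-congˡ G f≈f′ x = ∑-cong x (λ i _ → *-congʳ (f≈f′ (suc i) (s≤s z≤n)))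

  ◃-congʳ : ∀ f {G G′} → (∀ y → G y ≈ G′ y) → ∀ x → (f ◃ G) x ≈ (f ◃ G′) x
  ◃-congʳ f G≈G′ x = ∑-cong x (λ i _ → *-congˡ (G≈G′ _))

  ε-◃ : ∀ G x → 1 ≤ x → (ε ◃ G) x ≈ G x
  ε-◃ G (suc x) _ = begin
    1# * G (suc x / 1) + ∑ x (λ i → 0# * G (suc x / suc (suc i)))
      ≈⟨ +-cong (*-identityˡ _) (∑-zero x (λ i _ → zeroˡ _)) ⟩
    G (suc x / 1) + 0#  ≈⟨ +-identityʳ _ ⟩
    G (suc x / 1)       ≡⟨ ≡.cong G (n/1≡n (suc x)) ⟩
    G (suc x)           ∎

  sumTo-◃ : ∀ f x → sumTo f x ≈ (f ◃ (λ _ → 1#)) x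
  sumTo-◃ f x = ∑-cong x (λ i _ → sym (*-identityʳ (f (suc i))))

  sumFromTo-when : ∀ a b {n} (f : ℕ → Carrier) → b ≤ n →
    sumFromTo f (suc a) b ≈ ∑ n (λ j → when (a <? suc j ×-dec suc j ≤? b) (f (suc j)))
  sumFromTo-when zero    b       f b≤n = sym (∑-when-< (λ j → f (suc j)) b≤n)
  sumFromTo-when (suc a) zero {n} f _  =
    sym (∑-zero n (λ j _ → when-no (suc a <? suc j ×-dec suc j ≤? 0) (λ ())))
  sumFromTo-when (suc a) (suc b) {suc n} f (s≤s b≤n) =
    trans (sumFromTo-when a b (λ j → f (suc j)) b≤n) (sym (+-identityˡ _))

  ⋆-as-∑ : ∀ f g n → (f ⋆ g) n ≡ ∑ n (λ i → when (suc i ∣? n) (f (suc i) * g (n / suc i)))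
  ⋆-as-∑ f g n = ≡.cong (foldr _+_ 0#) (map-applyUpTo id _ n)

  ⋆-◃ : ∀ f g G x → ((f ⋆ g) ◃ G) x ≈ (f ◃ (g ◃ G)) x
  ⋆-◃ f g G x = begin
    ((f ⋆ g) ◃ G) x                  ≈⟨ ∑-cong x expand ⟩
    ∑ x (λ n → ∑ x (λ i → term i n)) ≈⟨ ∑-swap x x (λ n i → term i n) ⟩
    ∑ x (λ i → ∑ x (term i))         ≈⟨ ∑-cong x (λ i _ → collect i) ⟩
    (f ◃ (g ◃ G)) x                  ∎
    where
    divisorTerm : ℕ → ℕ → Carrier
    divisorTerm n i = when (suc i ∣? suc n) (f (suc i) * g (suc n / suc i))

    term : ℕ → ℕ → Carrier
    term i n = when (suc i ∣? suc n) (f (suc i) * g (suc n / suc i) * G (x / suc n))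

    expand : ∀ n → n < x → (f ⋆ g) (suc n) * G (x / suc n) ≈ ∑ x (λ i → term i n)
    expand n n<x = begin
      (f ⋆ g) (suc n) * G (x / suc n)          ≡⟨ ≡.cong (_* G (x / suc n)) (⋆-as-∑ f g (suc n)) ⟩
      ∑ (suc n) (divisorTerm n) * G (x / suc n) ≈⟨ *-distribʳ-∑ (suc n) (G (x / suc n)) (divisorTerm n) ⟩
      ∑ (suc n) (λ i → divisorTerm n i * G (x / suc n))
        ≈⟨ ∑-cong (suc n) (λ i _ →
             *-distribʳ-when (suc i ∣? suc n) (f (suc i) * g (suc n / suc i)) (G (x / suc n))) ⟩
      ∑ (suc n) (λ i → term i n)
        ≈⟨ ∑-vanishing-tail n<x (λ i n<i _ →
             when-no (suc i ∣? suc n) (λ i+1∣ → <⇒≱ n<i (≤-pred (∣⇒≤ i+1∣)))) ⟨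
      ∑ x (λ i → term i n)                     ∎

    collect : ∀ i → ∑ x (term i) ≈ f (suc i) * (g ◃ G) (x / suc i)
    collect i = begin
      ∑ x (term i)                                     ≈⟨ ∑-cong x (λ n _ → factor n) ⟩
      ∑ x (λ n → f d * when (d ∣? suc n) (h (n / d)))  ≈⟨ *-distribˡ-∑ x (f d) _ ⟨
      f d * ∑ x (λ n → when (d ∣? suc n) (h (n / d)))  ≈⟨ *-congˡ (∑-when-∣ x d h) ⟩
      f d * ∑ (x / d) h                                ∎
      where
      d = suc i
      h : ℕ → Carrier
      h e = g (suc e) * G (x / d / suc e)
      factor : ∀ n → term i n ≈ f d * when (d ∣? suc n) (h (n / d))
      factor n = trans (when-cong (d ∣? suc n) (d ∣? suc n) id id reindex)
                       (sym (*-distribˡ-when (d ∣? suc n) _ _))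
        where
        reindex : d ∣ suc n → f d * g (suc n / d) * G (x / suc n) ≈ f d * h (n / d)
        reindex d∣ = trans (*-assoc _ _ _) (*-congˡ (reflexive (≡.cong₂ (λ e y → g e * G y)
                       (1+n/d≡1+[n/d] d d∣) (x/[1+n]≡x/d/[1+n/d] x d d∣))))

  underHyperbola : (f g G : ℕ → Carrier) (x d e : ℕ) → Carrier
  underHyperbola f g G x d e =
    when (suc d *ℕ suc e ≤? x) (f (suc d) * g (suc e) * G (x / (suc d *ℕ suc e)))

  ◃-◃-as-∑² : ∀ f g G x → (f ◃ (g ◃ G)) x ≈ ∑ x (λ d → ∑ x (underHyperbola f g G x d))
  ◃-◃-as-∑² f g G x = ∑-cong x (λ d _ → row d)
    where
    row : ∀ d → f (suc d) * (g ◃ G) (x / suc d) ≈ ∑ x (underHyperbola f g G x d)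
    row d = begin
      f (suc d) * ∑ (x / suc d) (λ e → g (suc e) * G (x / suc d / suc e))
        ≈⟨ *-distribˡ-∑ (x / suc d) (f (suc d)) _ ⟩
      ∑ (x / suc d) (λ e → f (suc d) * (g (suc e) * G (x / suc d / suc e)))
        ≈⟨ ∑-when-< _ (m/n≤m x (suc d)) ⟨
      ∑ x (λ e → when (e <? x / suc d) (f (suc d) * (g (suc e) * G (x / suc d / suc e))))
        ≈⟨ ∑-cong x (λ e _ → when-cong (e <? x / suc d) (suc d *ℕ suc e ≤? x)
             (λ e<x/d → m≤o/n⇒m*n≤o (suc e) (m≤o/n⇒n≤o/m {x} (suc e) (suc d) e<x/d))
             (λ de≤x → m≤o/n⇒n≤o/m {x} (suc d) (suc e) (m*n≤o⇒m≤o/n (suc e) de≤x))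
             (λ _ → trans (sym (*-assoc _ _ _))
                          (*-congˡ (reflexive (≡.cong G (m/n/o≡m/[n*o] x (suc d) (suc e))))))) ⟩
      ∑ x (underHyperbola f g G x d) ∎

  ◃-comm : ∀ f g G x → (f ◃ (g ◃ G)) x ≈ (g ◃ (f ◃ G)) x
  ◃-comm f g G x = begin
    (f ◃ (g ◃ G)) x                                ≈⟨ ◃-◃-as-∑² f g G x ⟩
    ∑ x (λ d → ∑ x (underHyperbola f g G x d))     ≈⟨ ∑-swap x x (underHyperbola f g G x) ⟩
    ∑ x (λ e → ∑ x (λ d → underHyperbola f g G x d e))
      ≈⟨ ∑-cong x (λ e _ → ∑-cong x (λ d _ → symmetric d e)) ⟩
    ∑ x (λ e → ∑ x (underHyperbola g f G x e))     ≈⟨ ◃-◃-as-∑² g f G x ⟨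
    (g ◃ (f ◃ G)) x                                ∎
    where
    symmetric : ∀ d e → underHyperbola f g G x d e ≈ underHyperbola g f G x e d
    symmetric d e = when-cong (suc d *ℕ suc e ≤? x) (suc e *ℕ suc d ≤? x)
      (≡.subst (_≤ x) (ℕₚ.*-comm (suc d) (suc e))) (≡.subst (_≤ x) (ℕₚ.*-comm (suc e) (suc d)))
      (λ _ → *-cong (*-comm _ _) (reflexive (≡.cong G (/-congʳ {m = x} (ℕₚ.*-comm (suc d) (suc e))))))

  ◃-by-quotients : ∀ F G x →
    sumOneTo (λ k → sumFromTo F (x / suc k +ℕ 1) (x / k) * G k) x ≈ (F ◃ G) x
  ◃-by-quotients F G x = begin
    ∑ x (λ k → sumFromTo F (x / suc (suc k) +ℕ 1) (x / suc k) * G (suc k))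
      ≈⟨ ∑-cong x (λ k _ → *-congʳ (block k)) ⟩
    ∑ x (λ k → ∑ x (fibre k) * G (suc k))
      ≈⟨ ∑-cong x (λ k _ → *-distribʳ-∑ x (G (suc k)) (fibre k)) ⟩
    ∑ x (λ k → ∑ x (λ j → fibre k j * G (suc k)))
      ≈⟨ ∑-cong x (λ k _ → ∑-cong x (λ j _ →
           *-distribʳ-when (x / suc j ≟ suc k) (F (suc j)) (G (suc k)))) ⟩
    ∑ x (λ k → ∑ x (λ j → when (x / suc j ≟ suc k) (F (suc j) * G (suc k))))
      ≈⟨ ∑-swap x x (λ k j → when (x / suc j ≟ suc k) (F (suc j) * G (suc k))) ⟩
    ∑ x (λ j → ∑ x (λ k → when (x / suc j ≟ suc k) (F (suc j) * G (suc k))))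
      ≈⟨ ∑-cong x (λ j j<x →
           ∑-when-≡ (λ k → F (suc j) * G k) (m≥n⇒m/n>0 {x} j<x) (m/n≤m x (suc j))) ⟩
    (F ◃ G) x ∎
    where
    fibre : ℕ → ℕ → Carrier
    fibre k j = when (x / suc j ≟ suc k) (F (suc j))

    block : ∀ k → sumFromTo F (x / suc (suc k) +ℕ 1) (x / suc k) ≈ ∑ x (fibre k)
    block k = begin
      sumFromTo F (x / suc (suc k) +ℕ 1) (x / suc k)
        ≡⟨ ≡.cong (λ a → sumFromTo F a (x / suc k)) (ℕₚ.+-comm (x / suc (suc k)) 1) ⟩
      sumFromTo F (suc (x / suc (suc k))) (x / suc k)
        ≈⟨ sumFromTo-when (x / suc (suc k)) (x / suc k) F (m/n≤m x (suc k)) ⟩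
      ∑ x (λ j → when (x / suc (suc k) <? suc j ×-dec suc j ≤? x / suc k) (F (suc j)))
        ≈⟨ ∑-cong x (λ j _ →
             when-cong (x / suc (suc k) <? suc j ×-dec suc j ≤? x / suc k) (x / suc j ≟ suc k)
             (uncurry (x/[1+m]<n≤x/m⇒x/n≡m {x} (suc j) (suc k)))
             (x/n≡m⇒x/[1+m]<n≤x/m {x} (suc j) (suc k)) (λ _ → refl)) ⟩
      ∑ x (fibre k) ∎

  Rtilde-as-◃ : ∀ r x → Rtilde r x ≈ (r ◃ M) x
  Rtilde-as-◃ r x = begin
    Rtilde r x                       ≈⟨ sumTo-◃ (r ⋆ μR) x ⟩
    ((r ⋆ μR) ◃ (λ _ → 1#)) x        ≈⟨ ⋆-◃ r μR (λ _ → 1#) x ⟩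
    (r ◃ (μR ◃ (λ _ → 1#))) x        ≈⟨ ◃-congʳ r (λ y → sym (sumTo-◃ μR y)) x ⟩
    (r ◃ M) x                        ∎

corollary1p3 : ∀ {c ℓ : Level} (R : CommutativeRing c ℓ) →
    let open CommutativeRing R in
    let open ArithFun R in
    (r rinv : ℕ → Carrier) →
    ¬ (r 1 ≈ 0#) →
    IsDirichletInverse r rinv →
    (x : ℕ) → 1 ≤ x →
    M x ≈ sumOneTo (λ k → sumFromTo rinv (x / suc k +ℕ 1) (x / k) * Rtilde r k) x
-- r 1 ≉ 0 only guarantees that an inverse exists; the identity holds for any inverse given.
corollary1p3 R r rinv _ r⋆rinv≈ε x 1≤x = begin
  M x                             ≈⟨ ε-◃ M x 1≤x ⟨
  (ε ◃ M) x                       ≈⟨ ◃-congˡ M (λ n 1≤n → sym (r⋆rinv≈ε n 1≤n)) x ⟩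
  ((r ⋆ rinv) ◃ M) x              ≈⟨ ⋆-◃ r rinv M x ⟩
  (r ◃ (rinv ◃ M)) x              ≈⟨ ◃-comm r rinv M x ⟩
  (rinv ◃ (r ◃ M)) x              ≈⟨ ◃-congʳ rinv (λ y → sym (Rtilde-as-◃ r y)) x ⟩
  (rinv ◃ Rtilde r) x             ≈⟨ ◃-by-quotients rinv (Rtilde r) x ⟨
  sumOneTo (λ k → sumFromTo rinv (x / suc k +ℕ 1) (x / k) * Rtilde r k) x ∎
  where
  open CommutativeRing R
  open ArithFun R
  open DirichletAction R
  open import Relation.Binary.Reasoning.Setoid setoid
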